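{- Let $\mathbf u,\mathbf v,\mathbf w$ be finite real sequences, $\mathbf w$ of length $s$, and let $k\in\mathbb{Z}_+$. Then $$S(M^k(\mathbf u,\mathbf v,\mathbf w))=S(M^k(\mathbf u,\mathbf w))+\sum_{\ell=0}^{k}\binom{s+k-1-\ell}{k-\ell}\Big(S(M^{\ell}(\mathbf u,\mathbf v))-S(M^\ell(\mathbf u))\Big).$$
   Context: $(\cdot,\cdot)$ and $(\cdot,\cdot,\cdot)$ denote concatenation of finite sequences. For a finite sequence $\mathbf a=(a_1,\dots,a_m)$, $S(\mathbf a)=\sum_i a_i$ and $M(\mathbf a)=(a_1,a_1+a_2,\dots,a_1+\dots+a_m)$; $M^0$ is the identity and $M^k=M\circ M^{k-1}$. -}

module Defs where

open import Level using (Level)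
open import Algebra.Bundles using (CommutativeRing)
open import Data.Nat using (ℕ; zero; suc)
open import Data.List using (List; []; _∷_; map)

module Seq {c ℓ : Level} (R : CommutativeRing c ℓ) where
  open CommutativeRing R public

  S : List Carrier → Carrier
  S []       = 0#
  S (x ∷ xs) = x + S xs

  M : List Carrier → List Carrier
  M []       = []
  M (x ∷ xs) = x ∷ map (x +_) (M xs)

  M^ : ℕ → List Carrier → List Carrier
  M^ zero    a = a
  M^ (suc k) a = M (M^ k a)

  _·_ : ℕ → Carrier → Carrier
  zero  · x = 0#
  suc n · x = x + (n · x)

  Σ≤ : ℕ → (ℕ → Carrier) → Carrier
  Σ≤ zero    f = f 0
  Σ≤ (suc k) f = Σ≤ k f + f (suc k)

module Submission where

-- Write T k a = S (M^k a).  The proof rests on one "Pascal rule" for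
-- iterated partial sums: appending an entry x to a sequence a gives
--
--     T (k+1) (a ++ [x]) = T (k+1) a + T k (a ++ [x]),
--
-- because M^k (a ++ [x]) is M^k a followed by a single new entry y, and
-- applying M once more adds exactly S (M^k a) + y = T k (a ++ [x]) to the sum.
-- Hence for fixed u, v the difference D k w = T k (u++v++w) - T k (u++w)
-- satisfies D (k+1) (w ++ [x]) = D (k+1) w + D k (w ++ [x]) and D 0 w = S v.
-- Independently, the binomial sums F s k = Σ_{l ≤ k} C(s+k-1-l, k-l) · d l
-- obey the same recurrence in (s, k) by Pascal's rule for binomial
-- coefficients, with F 0 k = d k and F s 0 = d 0.  A general uniqueness
-- lemma (induction on w from the right, then on k) shows that any family of
-- list functionals obeying the recurrence equals the binomial sum of its
-- values at w = [].  Applied to D, whose values at [] are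
-- d l = T l (u ++ v) - T l u, this is the corollary (which in fact holds
-- for k = 0 as well).

open import Defs
open import Level using (Level)
open import Algebra.Bundles using (CommutativeRing)
open import Data.Nat using (ℕ; _∸_; _≤_; zero; suc; z≤n)
open import Data.Nat.Combinatorics using (_C_; k>n⇒nCk≡0; nCk+nC[k+1]≡[n+1]C[k+1])
open import Data.List using (List; _++_; length; []; _∷_; map; [_])
open import Data.List.Properties using (++-assoc; ++-identityʳ; length-++; map-++)
open import Data.List.Reverse using (Reverse; reverseView; []; _∶_∶ʳ_)
open import Data.Product using (∃; _,_)
import Data.Nat as ℕ
import Data.Nat.Properties as ℕₚ
open import Relation.Binary.PropositionalEquality as P using (_≡_)
import Algebra.Properties.AbelianGroup as AbelianGroupProperties
import Algebra.Properties.CommutativeSemigroup as CommutativeSemigroupProperties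
import Data.List.Relation.Binary.Equality.Setoid as ListEquality
import Relation.Binary.Reasoning.Setoid as SetoidReasoning

module Development {c ℓ : Level} (R : CommutativeRing c ℓ) where
  open Seq R
  open AbelianGroupProperties +-abelianGroup using (⁻¹-∙-comm)
  open CommutativeSemigroupProperties +-commutativeSemigroup using (interchange)
  open ListEquality setoid using (_≋_; _∷_; []; ≋-refl; ≋-trans; ++⁺)
  open SetoidReasoning setoid

  minus-interchange : ∀ a b c d → (a + b) - (c + d) ≈ (a - c) + (b - d)
  minus-interchange a b c d =
    trans (+-congˡ (sym (⁻¹-∙-comm c d))) (interchange a b (- c) (- d))

  ≈-plus-difference : ∀ x y → x ≈ y + (x - y)
  ≈-plus-difference x y = begin
    x                ≈⟨ sym (+-identityˡ x) ⟩
    0# + x           ≈⟨ +-congʳ (sym (-‿inverseʳ y)) ⟩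
    (y - y) + x      ≈⟨ +-assoc y (- y) x ⟩
    y + (- y + x)    ≈⟨ +-congˡ (+-comm (- y) x) ⟩
    y + (x - y)      ∎

  ·-distrib-+ℕ : ∀ m n x → (m ℕ.+ n) · x ≈ m · x + n · x
  ·-distrib-+ℕ zero    n x = sym (+-identityˡ _)
  ·-distrib-+ℕ (suc m) n x = trans (+-congˡ (·-distrib-+ℕ m n x)) (sym (+-assoc _ _ _))

  Σ≤-cong : ∀ k {f g : ℕ → Carrier} → (∀ l → l ≤ k → f l ≈ g l) → Σ≤ k f ≈ Σ≤ k g
  Σ≤-cong zero    f≈g = f≈g 0 z≤n
  Σ≤-cong (suc k) f≈g =
    +-cong (Σ≤-cong k (λ l l≤k → f≈g l (ℕₚ.m≤n⇒m≤1+n l≤k))) (f≈g (suc k) ℕₚ.≤-refl)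

  Σ≤-+ : ∀ k (f g : ℕ → Carrier) → Σ≤ k (λ l → f l + g l) ≈ Σ≤ k f + Σ≤ k g
  Σ≤-+ zero    f g = refl
  Σ≤-+ (suc k) f g = trans (+-congʳ (Σ≤-+ k f g)) (interchange _ _ _ _)

  Σ≤-zero : ∀ k → Σ≤ k (λ _ → 0#) ≈ 0#
  Σ≤-zero zero    = refl
  Σ≤-zero (suc k) = trans (+-identityʳ _) (Σ≤-zero k)

  S-cong : ∀ {a b} → a ≋ b → S a ≈ S b
  S-cong []           = refl
  S-cong (x≈y ∷ a≋b)  = +-cong x≈y (S-cong a≋b)

  S-++ : ∀ a b → S (a ++ b) ≈ S a + S b
  S-++ []      b = sym (+-identityˡ _)
  S-++ (x ∷ a) b = trans (+-congˡ (S-++ a b)) (sym (+-assoc _ _ _))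

  S-singleton : ∀ x → S [ x ] ≈ x
  S-singleton = +-identityʳ

  map-+-cong : ∀ {a b p q} → a ≈ b → p ≋ q → map (a +_) p ≋ map (b +_) q
  map-+-cong a≈b []          = []
  map-+-cong a≈b (x≈y ∷ p≋q) = +-cong a≈b x≈y ∷ map-+-cong a≈b p≋q

  M-cong : ∀ {a b} → a ≋ b → M a ≋ M b
  M-cong []          = []
  M-cong (x≈y ∷ a≋b) = x≈y ∷ map-+-cong x≈y (M-cong a≋b)

  M-snoc : ∀ a y → M (a ++ [ y ]) ≋ M a ++ [ S a + y ]
  M-snoc []      y = sym (+-identityˡ y) ∷ []
  M-snoc (x ∷ a) y = refl ∷ ≋-trans shifted (++⁺ ≋-refl (sym (+-assoc x (S a) y) ∷ []))
    where
    shifted : map (x +_) (M (a ++ [ y ])) ≋ map (x +_) (M a) ++ [ x + (S a + y) ]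
    shifted = P.subst (map (x +_) (M (a ++ [ y ])) ≋_) (map-++ (x +_) (M a) [ S a + y ])
                      (map-+-cong refl (M-snoc a y))

  M^-snoc : ∀ k a x → ∃ λ y → M^ k (a ++ [ x ]) ≋ M^ k a ++ [ y ]
  M^-snoc zero    a x = x , ≋-refl
  M^-snoc (suc k) a x with M^-snoc k a x
  ... | y , eq = S (M^ k a) + y , ≋-trans (M-cong eq) (M-snoc (M^ k a) y)

  T : ℕ → List Carrier → Carrier
  T k a = S (M^ k a)

  -- Appending x adds to T (k+1) a exactly the new final entry T k (a ++ [x]).
  T-snoc : ∀ k a x → T (suc k) (a ++ [ x ]) ≈ T (suc k) a + T k (a ++ [ x ])
  T-snoc k a x with M^-snoc k a x
  ... | y , eq = begin
    S (M (M^ k (a ++ [ x ])))                 ≈⟨ S-cong (≋-trans (M-cong eq) (M-snoc (M^ k a) y)) ⟩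
    S (M (M^ k a) ++ [ S (M^ k a) + y ])      ≈⟨ S-++ (M (M^ k a)) _ ⟩
    T (suc k) a + S [ S (M^ k a) + y ]        ≈⟨ +-congˡ (S-singleton _) ⟩
    T (suc k) a + (S (M^ k a) + y)            ≈˘⟨ +-congˡ (+-congˡ (S-singleton y)) ⟩
    T (suc k) a + (S (M^ k a) + S [ y ])      ≈˘⟨ +-congˡ (S-++ (M^ k a) [ y ]) ⟩
    T (suc k) a + S (M^ k a ++ [ y ])         ≈˘⟨ +-congˡ (S-cong eq) ⟩
    T (suc k) a + T k (a ++ [ x ])            ∎

  coeff : ℕ → ℕ → ℕ → ℕ
  coeff s k l = (s ℕ.+ k ∸ 1 ∸ l) C (k ∸ l)

  F : ℕ → ℕ → (ℕ → Carrier) → Carrier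
  F s k d = Σ≤ k (λ l → coeff s k l · d l)

  coeff-pascal : ∀ s k l → l ≤ k →
                 coeff (suc s) (suc k) l ≡ coeff s (suc k) l ℕ.+ coeff (suc s) k l
  coeff-pascal s k l l≤k
    rewrite ℕₚ.+-∸-assoc 1 l≤k | ℕₚ.+-suc s k
          | ℕₚ.+-∸-assoc 1 (ℕₚ.≤-trans l≤k (ℕₚ.m≤n+m k s))
    = P.trans (P.sym (nCk+nC[k+1]≡[n+1]C[k+1] (s ℕ.+ k ∸ l) (k ∸ l)))
              (ℕₚ.+-comm ((s ℕ.+ k ∸ l) C (k ∸ l)) ((s ℕ.+ k ∸ l) C suc (k ∸ l)))

  -- With s = 0 every coefficient below the diagonal is C(k-l-1, k-l) = 0.
  coeff-empty : ∀ k l → l ≤ k → coeff 0 (suc k) l ≡ 0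
  coeff-empty k l l≤k rewrite ℕₚ.+-∸-assoc 1 l≤k = k>n⇒nCk≡0 {k ∸ l} {suc (k ∸ l)} ℕₚ.≤-refl

  diagonal-term : ∀ s k (d : ℕ → Carrier) → coeff s k k · d k ≈ d k
  diagonal-term s k d rewrite ℕₚ.n∸n≡0 k = +-identityʳ (d k)

  F-zeroʳ : ∀ s (d : ℕ → Carrier) → F s 0 d ≈ d 0
  F-zeroʳ s d = diagonal-term s 0 d

  F-zeroˡ : ∀ k (d : ℕ → Carrier) → F 0 k d ≈ d k
  F-zeroˡ zero    d = F-zeroʳ 0 d
  F-zeroˡ (suc k) d = begin
    Σ≤ k (λ l → coeff 0 (suc k) l · d l) + coeff 0 (suc k) (suc k) · d (suc k)
      ≈⟨ +-cong (Σ≤-cong k vanish) (diagonal-term 0 (suc k) d) ⟩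
    Σ≤ k (λ _ → 0#) + d (suc k)   ≈⟨ +-congʳ (Σ≤-zero k) ⟩
    0# + d (suc k)                ≈⟨ +-identityˡ _ ⟩
    d (suc k)                     ∎
    where
    vanish : ∀ l → l ≤ k → coeff 0 (suc k) l · d l ≈ 0#
    vanish l l≤k rewrite coeff-empty k l l≤k = refl

  F-pascal : ∀ s k (d : ℕ → Carrier) → F (suc s) (suc k) d ≈ F s (suc k) d + F (suc s) k d
  F-pascal s k d = begin
    Σ≤ k (λ l → coeff (suc s) (suc k) l · d l) + coeff (suc s) (suc k) (suc k) · d (suc k)
      ≈⟨ +-cong (Σ≤-cong k split) (diagonal-term (suc s) (suc k) d) ⟩
    Σ≤ k (λ l → coeff s (suc k) l · d l + coeff (suc s) k l · d l) + d (suc k)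
      ≈⟨ +-congʳ (Σ≤-+ k _ _) ⟩
    (Σ≤ k (λ l → coeff s (suc k) l · d l) + F (suc s) k d) + d (suc k)
      ≈⟨ +-assoc _ _ _ ⟩
    Σ≤ k (λ l → coeff s (suc k) l · d l) + (F (suc s) k d + d (suc k))
      ≈⟨ +-congˡ (+-comm _ _) ⟩
    Σ≤ k (λ l → coeff s (suc k) l · d l) + (d (suc k) + F (suc s) k d)
      ≈˘⟨ +-assoc _ _ _ ⟩
    (Σ≤ k (λ l → coeff s (suc k) l · d l) + d (suc k)) + F (suc s) k d
      ≈˘⟨ +-congʳ (+-congˡ (diagonal-term s (suc k) d)) ⟩
    F s (suc k) d + F (suc s) k d
      ∎
    where
    split : ∀ l → l ≤ k → coeff (suc s) (suc k) l · d l
                          ≈ coeff s (suc k) l · d l + coeff (suc s) k l · d l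
    split l l≤k = trans (reflexive (P.cong (_· d l) (coeff-pascal s k l l≤k)))
                        (·-distrib-+ℕ (coeff s (suc k) l) (coeff (suc s) k l) (d l))

  length-snoc : ∀ (w : List Carrier) x → length (w ++ [ x ]) ≡ suc (length w)
  length-snoc w x = P.trans (length-++ w) (ℕₚ.+-comm (length w) 1)

  module Recurrence (D : ℕ → List Carrier → Carrier)
         (D-zero : ∀ w → D 0 w ≈ D 0 [])
         (D-snoc : ∀ k w x → D (suc k) (w ++ [ x ]) ≈ D (suc k) w + D k (w ++ [ x ]))
         where

    boundary : ℕ → Carrier
    boundary l = D l []

    solution : ∀ {w} → Reverse w → ∀ k → D k w ≈ F (length w) k boundary
    solution []              k       = sym (F-zeroˡ k boundary)
    solution (w ∶ _ ∶ʳ x)    zero    = trans (D-zero _) (sym (F-zeroʳ (length (w ++ [ x ])) boundary))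
    solution (w ∶ rw ∶ʳ x)   (suc k) = begin
      D (suc k) (w ++ [ x ])
        ≈⟨ D-snoc k w x ⟩
      D (suc k) w + D k (w ++ [ x ])
        ≈⟨ +-cong (solution rw (suc k)) (solution (w ∶ rw ∶ʳ x) k) ⟩
      F (length w) (suc k) boundary + F (length (w ++ [ x ])) k boundary
        ≡⟨ P.cong (λ n → F (length w) (suc k) boundary + F n k boundary) (length-snoc w x) ⟩
      F (length w) (suc k) boundary + F (suc (length w)) k boundary
        ≈˘⟨ F-pascal (length w) k boundary ⟩
      F (suc (length w)) (suc k) boundary
        ≡˘⟨ P.cong (λ n → F n (suc k) boundary) (length-snoc w x) ⟩
      F (length (w ++ [ x ])) (suc k) boundary
        ∎

  module Insertion (u v : List Carrier) where

    D : ℕ → List Carrier → Carrier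
    D k w = T k (u ++ v ++ w) - T k (u ++ w)

    D-zero : ∀ w → D 0 w ≈ D 0 []
    D-zero w = trans (S-difference w) (sym (S-difference []))
      where
      S-difference : ∀ w → D 0 w ≈ S v
      S-difference w = begin
        S (u ++ v ++ w) - S (u ++ w)
          ≈⟨ +-cong (trans (S-++ u (v ++ w)) (+-congˡ (S-++ v w))) (-‿cong (S-++ u w)) ⟩
        (S u + (S v + S w)) - (S u + S w)    ≈⟨ minus-interchange _ _ _ _ ⟩
        (S u - S u) + ((S v + S w) - S w)    ≈⟨ +-cong (-‿inverseʳ (S u)) (+-assoc _ _ _) ⟩
        0# + (S v + (S w - S w))             ≈⟨ +-identityˡ _ ⟩
        S v + (S w - S w)                    ≈⟨ +-congˡ (-‿inverseʳ (S w)) ⟩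
        S v + 0#                             ≈⟨ +-identityʳ _ ⟩
        S v                                  ∎

    D-snoc : ∀ k w x → D (suc k) (w ++ [ x ]) ≈ D (suc k) w + D k (w ++ [ x ])
    D-snoc k w x = begin
      T (suc k) (u ++ v ++ (w ++ [ x ])) - T (suc k) (u ++ (w ++ [ x ]))
        ≡⟨ P.cong₂ (λ a b → T (suc k) a - T (suc k) b) reassocₗ reassocᵣ ⟩
      T (suc k) (A ++ [ x ]) - T (suc k) (B ++ [ x ])
        ≈⟨ +-cong (T-snoc k A x) (-‿cong (T-snoc k B x)) ⟩
      (T (suc k) A + T k (A ++ [ x ])) - (T (suc k) B + T k (B ++ [ x ]))
        ≈⟨ minus-interchange _ _ _ _ ⟩
      D (suc k) w + (T k (A ++ [ x ]) - T k (B ++ [ x ]))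
        ≡˘⟨ P.cong₂ (λ a b → D (suc k) w + (T k a - T k b)) reassocₗ reassocᵣ ⟩
      D (suc k) w + D k (w ++ [ x ])
        ∎
      where
      A = u ++ v ++ w
      B = u ++ w
      reassocₗ : u ++ v ++ (w ++ [ x ]) ≡ A ++ [ x ]
      reassocₗ = P.sym (P.trans (++-assoc u (v ++ w) [ x ]) (P.cong (u ++_) (++-assoc v w [ x ])))
      reassocᵣ : u ++ (w ++ [ x ]) ≡ B ++ [ x ]
      reassocᵣ = P.sym (++-assoc u w [ x ])

    D-empty : ∀ l → D l [] ≡ T l (u ++ v) - T l u
    D-empty l rewrite ++-identityʳ v | ++-identityʳ u = P.refl

corollary4 : ∀ {c ℓ} (R : CommutativeRing c ℓ) →
    let open Seq R in
    (u v w : List Carrier) (k : ℕ) → 1 ≤ k →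
    S (M^ k (u ++ v ++ w))
    ≈ S (M^ k (u ++ w))
    + Σ≤ k (λ l → ((Data.Nat._+_ (length w) k ∸ 1 ∸ l) C (k ∸ l))
    · (S (M^ l (u ++ v)) - S (M^ l u)))
corollary4 R u v w k _ = begin
  T k (u ++ v ++ w)                          ≈⟨ ≈-plus-difference _ _ ⟩
  T k (u ++ w) + D k w                       ≈⟨ +-congˡ (solution (reverseView w) k) ⟩
  T k (u ++ w) + F (length w) k (λ l → D l [])
    ≈⟨ +-congˡ (Σ≤-cong k (λ l _ → reflexive (P.cong (coeff (length w) k l ·_) (D-empty l)))) ⟩
  T k (u ++ w) + F (length w) k (λ l → T l (u ++ v) - T l u) ∎
  where
  open Development R
  open Seq R
  open Insertion u v
  open Recurrence D D-zero D-snoc using (solution)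
  open SetoidReasoning setoid
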